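{- Let $k$ and $m$ be natural numbers with $k$ odd. If a necklace is $2k$-wiggly, then it has a cycle of length congruent to $m$ modulo $k$.
   Context: All graphs are finite and simple. An $A-B$ path is a path with one end in $A$, one end in $B$, and no internal vertex in $A\cup B$. Let $\mathcal{B}=\{B_1,\dots,B_\ell\}$ be a collection of pairwise disjoint 2-connected subgraphs of a graph $G$. A $\mathcal{B}$-necklace is a subgraph of $G$ consisting of $B_1,\dots,B_\ell$ and $\ell$ pairwise disjoint paths $P_1,\dots,P_\ell$ such that $P_i$ is a $B_i-B_{i+1}$ path for $i<\ell$, $P_\ell$ is a $B_\ell-B_1$ path, and no interior vertex of any $P_i$ lies in any $B_j$. A necklace is a $\mathcal{B}$-necklace for some such $\mathcal{B}$. For each $i$ let $x_i,y_i$ be the two vertices of $B_i$ contained in some path $P_j$. The necklace is $n$-wiggly if there is $I\subseteq\{1,\dots,\ell\}$ with $|I|=n$ such that for every $i\in I$, $B_i$ contains two $x_i-y_i$ paths whose lengths differ by 1 or 2. -}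

module Defs where

open import Data.Nat using (ℕ; zero; suc; _+_; _*_; _≤_)
open import Data.Nat.DivMod using (_mod_)
open import Data.Fin using (Fin; toℕ)
open import Data.Fin.Subset using (Subset; _∈_; ∣_∣)
open import Data.List using (List; []; _∷_; length)
open import Data.List.Membership.Propositional renaming (_∈_ to _∈ₗ_)
open import Data.List.Relation.Unary.All using (All)
open import Data.List.Relation.Unary.Unique.Propositional using (Unique)
open import Data.List.Relation.Unary.Linked using (Linked)
open import Data.Product using (Σ; ∃; ∃-syntax; _×_; _,_)
open import Data.Sum using (_⊎_)
open import Data.Unit using (⊤)
open import Data.Empty using (⊥)
open import Relation.Binary.PropositionalEquality using (_≡_; _≢_)
open import Relation.Nullary using (¬_)

Odd : ℕ → Set
Odd k = ∃[ j ] k ≡ suc (2 * j)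

Congruent : ℕ → ℕ → ℕ → Set
Congruent k a b = ∃[ q ] (a ≡ b + q * k ⊎ b ≡ a + q * k)

next : ∀ {ℓ} → Fin ℓ → Fin ℓ
next {suc ℓ} i = suc (toℕ i) mod (suc ℓ)

prev : ∀ {ℓ} → Fin ℓ → Fin ℓ
prev {suc ℓ} i = (toℕ i + ℓ) mod (suc ℓ)

record Graph : Set₁ where
  field
    n          : ℕ
    Adj        : Fin n → Fin n → Set
    Adj-sym    : ∀ {u v} → Adj u v → Adj v u
    Adj-irrefl : ∀ {u} → ¬ Adj u u

record VSeq (n : ℕ) : Set where
  constructor _∷ₚ_
  field
    first : Fin n
    rest  : List (Fin n)

open VSeq public

verts : ∀ {n} → VSeq n → List (Fin n)
verts p = first p ∷ rest p

lastOf : ∀ {n} → Fin n → List (Fin n) → Fin n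
lastOf h []       = h
lastOf h (t ∷ ts) = lastOf t ts

lastV : ∀ {n} → VSeq n → Fin n
lastV p = lastOf (first p) (rest p)

-- length = number of edges
len : ∀ {n} → VSeq n → ℕ
len p = length (rest p)

IsPathIn : ∀ {n} → (Fin n → Set) → (Fin n → Fin n → Set) → VSeq n → Set
IsPathIn V E p = Unique (verts p) × Linked E (verts p) × All V (verts p)

-- a cycle: a path with at least 3 vertices whose ends are joined by an edge;
-- its length is the number of its vertices (= edges)
IsCycleIn : ∀ {n} → (Fin n → Set) → (Fin n → Fin n → Set) → VSeq n → Set
IsCycleIn V E c = 2 ≤ len c × IsPathIn V E c × E (lastV c) (first c)

cycleLength : ∀ {n} → VSeq n → ℕ
cycleLength c = suc (len c)

Interior : ∀ {n} → VSeq n → Fin n → Set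
Interior p v = v ∈ₗ verts p × v ≢ first p × v ≢ lastV p

data Consec {n} : List (Fin n) → Fin n → Fin n → Set where
  here  : ∀ {u v xs} → Consec (u ∷ v ∷ xs) u v
  there : ∀ {x xs u v} → Consec xs u v → Consec (x ∷ xs) u v

PathEdge : ∀ {n} → VSeq n → Fin n → Fin n → Set
PathEdge p u v = Consec (verts p) u v ⊎ Consec (verts p) v u

ConnectedVE : ∀ {n} → (Fin n → Set) → (Fin n → Fin n → Set) → Set
ConnectedVE V E = ∀ u v → V u → V v →
  ∃[ p ] (IsPathIn V E p × first p ≡ u × lastV p ≡ v)

module _ (G : Graph) where
  open Graph G

  record Subgraph : Set₁ where
    field
      V      : Fin n → Set
      E      : Fin n → Fin n → Set
      E⊆Adj  : ∀ {u v} → E u v → Adj u v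
      E-sym  : ∀ {u v} → E u v → E v u
      E-ends : ∀ {u v} → E u v → V u × V v

  open Subgraph public

  TwoConnected : Subgraph → Set
  TwoConnected H =
    (∃[ a ] ∃[ b ] ∃[ c ] (V H a × V H b × V H c × a ≢ b × a ≢ c × b ≢ c))
    × ConnectedVE (V H) (E H)
    × (∀ w → V H w →
         ConnectedVE (λ u → V H u × u ≢ w)
                     (λ u v → E H u v × u ≢ w × v ≢ w))

  record Necklace : Set₁ where
    field
      ℓ       : ℕ
      B       : Fin ℓ → Subgraph
      P       : Fin ℓ → VSeq n
      B-2conn : ∀ i → TwoConnected (B i)
      B-disj  : ∀ i j → i ≢ j → ∀ u → V (B i) u → V (B j) u → ⊥
      P-path  : ∀ i → IsPathIn (λ _ → ⊤) Adj (P i)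
      P-first : ∀ i → V (B i) (first (P i))
      P-last  : ∀ i → V (B (next i)) (lastV (P i))
      P-int   : ∀ i j v → Interior (P i) v → ¬ V (B j) v
      P-disj  : ∀ i j → i ≢ j → ∀ v → v ∈ₗ verts (P i) → v ∈ₗ verts (P j) → ⊥

    xv : Fin ℓ → Fin n
    xv i = lastV (P (prev i))

    yv : Fin ℓ → Fin n
    yv i = first (P i)

    NV : Fin n → Set
    NV v = (∃[ i ] V (B i) v) ⊎ (∃[ i ] v ∈ₗ verts (P i))

    NE : Fin n → Fin n → Set
    NE u v = (∃[ i ] E (B i) u v) ⊎ (∃[ i ] PathEdge (P i) u v)

    Wiggly : ℕ → Set
    Wiggly w = ∃[ I ] (∣ I ∣ ≡ w × (∀ i → i ∈ I →
      ∃[ p ] ∃[ q ]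
        (IsPathIn (V (B i)) (E (B i)) p × first p ≡ xv i × lastV p ≡ yv i
        × IsPathIn (V (B i)) (E (B i)) q × first q ≡ xv i × lastV q ≡ yv i
        × (len q ≡ len p + 1 ⊎ len q ≡ len p + 2))))

    HasCycleMod : ℕ → ℕ → Set
    HasCycleMod k m = ∃[ c ] (IsCycleIn NV NE c × Congruent k (cycleLength c) m)

-- Choosing one x_i–y_i path in every bead B_i, the paths together with the interiors of
-- the connecting paths P_i close up into a cycle of the necklace. Fix a shorter path in
-- each bead; switching to the longer path in bead i adds its gap (1 or 2 in the at least
-- 2k beads witnessing wiggliness, 0 elsewhere), so the cycle lengths realised are a base
-- length plus all subset sums of the gaps. Either k gaps equal 1 or k gaps equal 2, and
-- as k is odd, 2 is invertible modulo k; taking a suitable number of these gaps hits every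
-- residue modulo k.

module Submission where

open import Defs
open import Data.Nat using (ℕ; zero; suc; _+_; _*_; _∸_; _≤_; z≤n; s≤s; s≤s⁻¹; NonZero)
open import Data.Nat.Properties
open import Data.Nat.DivMod
open import Data.Nat.Tactic.RingSolver using (solve-∀)
open import Data.Bool using (Bool; true; false; if_then_else_)
open import Data.Fin using (Fin; zero; suc; toℕ; fromℕ; inject₁)
open import Data.Fin.Properties using (toℕ-fromℕ<; toℕ-fromℕ; toℕ-inject₁; toℕ<n; toℕ-injective)
open import Data.Fin.Subset using (Subset; inside; outside; ∣_∣) renaming (_∈_ to _∈ₛ_)
open import Data.Fin.Subset.Properties using (∣p∣≤n; _∈?_)
open import Data.Vec using ([]; _∷_; here; there)
import Data.Vec.Functional as Vector
open import Data.List using (List; []; _∷_; _++_; [_]; length; concat; tabulate)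
open import Data.List.Properties using (length-++; ++-assoc; ++-identityʳ)
open import Data.List.Membership.Propositional using (_∈_)
open import Data.List.Membership.Propositional.Properties using (∈-++⁺ˡ; ∈-++⁺ʳ; ∈-++⁻)
open import Data.List.Relation.Unary.Any using (here; there)
open import Data.List.Relation.Unary.All as All using (All)
import Data.List.Relation.Unary.All.Properties as All
open import Data.List.Relation.Unary.AllPairs as AllPairs using ([]; _∷_)
import Data.List.Relation.Unary.AllPairs.Properties as AllPairs
open import Data.List.Relation.Unary.Unique.Propositional using (Unique)
import Data.List.Relation.Unary.Unique.Propositional.Properties as Unique
open import Data.List.Relation.Binary.Disjoint.Propositional using (Disjoint)
open import Data.List.Relation.Unary.Linked as Linked using (Linked; []; [-]; _∷_)
open import Data.Empty using (⊥)
open import Data.Product using (Σ; ∃-syntax; _×_; _,_; proj₁; proj₂)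
open import Data.Sum as Sum using (_⊎_; inj₁; inj₂)
open import Function using (_∘_)
open import Relation.Binary.PropositionalEquality using (_≡_; _≢_; refl; sym; trans; cong; cong₂; subst; subst₂; module ≡-Reasoning)
open import Relation.Nullary using (yes; no; contradiction)
open import Algebra.Properties.CommutativeMonoid.Sum +-0-commutativeMonoid
  using (sum-syntax; ∑-distrib-+; sum-replicate-zero; sum-cong-≗)

select : Bool → ℕ → ℕ
select b x = if b then x else 0

subsetSum : ∀ {n} → (Fin n → Bool) → (Fin n → ℕ) → ℕ
subsetSum {n} c d = ∑[ i < n ] select (c i) (d i)

count : ∀ {n} → ℕ → (Fin n → ℕ) → ℕ
count {zero}  v d = 0
count {suc n} v d with d zero ≟ v
... | yes _ = suc (count v (d ∘ suc))
... | no  _ = count v (d ∘ suc)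

count∘suc≤count : ∀ {n} v (d : Fin (suc n) → ℕ) → count v (d ∘ suc) ≤ count v d
count∘suc≤count v d with d zero ≟ v
... | yes _ = n≤1+n _
... | no  _ = ≤-refl

subsetSum-copies : ∀ {n} v (d : Fin n → ℕ) t → t ≤ count v d →
       ∃[ c ] subsetSum c d ≡ t * v
subsetSum-copies {n} v d zero    _  = (λ _ → false) , sum-replicate-zero n
subsetSum-copies {suc n} v d (suc t) t≤ with d zero ≟ v
... | yes d₀≡v = let c , Σ≡ = subsetSum-copies v (d ∘ suc) t (s≤s⁻¹ t≤) in
                 (true Vector.∷ c) , cong₂ _+_ d₀≡v Σ≡
... | no  _    = let c , Σ≡ = subsetSum-copies v (d ∘ suc) (suc t) t≤ in
                 (false Vector.∷ c) , Σ≡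

∣I∣≤count₁+count₂ : ∀ {n} (I : Subset n) (d : Fin n → ℕ) →
                    (∀ i → i ∈ₛ I → d i ≡ 1 ⊎ d i ≡ 2) → ∣ I ∣ ≤ count 1 d + count 2 d
∣I∣≤count₁+count₂ []      d h = z≤n
∣I∣≤count₁+count₂ (x ∷ I) d h with ∣I∣≤count₁+count₂ I (d ∘ suc) (λ i i∈I → h (suc i) (there i∈I))
∣I∣≤count₁+count₂ (outside ∷ I) d h | ih =
  ≤-trans ih (+-mono-≤ (count∘suc≤count 1 d) (count∘suc≤count 2 d))
∣I∣≤count₁+count₂ (inside ∷ I) d h | ih with d zero ≟ 1
... | yes _ = s≤s (≤-trans ih (+-monoʳ-≤ _ (count∘suc≤count 2 d)))
... | no ≢1 with d zero ≟ 2
...   | yes _ = subst (suc ∣ I ∣ ≤_) (sym (+-suc _ _)) (s≤s ih)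
...   | no ≢2 with h zero here
...     | inj₁ d≡1 = contradiction d≡1 ≢1
...     | inj₂ d≡2 = contradiction d≡2 ≢2

module _ (k : ℕ) .{{_ : NonZero k}} where

  [m%k*n]%k≡[m*n]%k : ∀ m n → (m % k * n) % k ≡ (m * n) % k
  [m%k*n]%k≡[m*n]%k m n = begin
    (m % k * n) % k            ≡⟨ %-distribˡ-* (m % k) n k ⟩
    (m % k % k * (n % k)) % k  ≡⟨ cong (λ x → (x * (n % k)) % k) (m%n%n≡m%n m k) ⟩
    (m % k * (n % k)) % k      ≡⟨ %-distribˡ-* m n k ⟨
    (m * n) % k                ∎
    where open ≡-Reasoning

  [m+n%k]%k≡[m+n]%k : ∀ m n → (m + n % k) % k ≡ (m + n) % k
  [m+n%k]%k≡[m+n]%k m n = begin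
    (m + n % k) % k            ≡⟨ %-distribˡ-+ m (n % k) k ⟩
    (m % k + n % k % k) % k    ≡⟨ cong (λ x → (m % k + x) % k) (m%n%n≡m%n n k) ⟩
    (m % k + n % k) % k        ≡⟨ %-distribˡ-+ m n k ⟨
    (m + n) % k                ∎
    where open ≡-Reasoning

  r+b*k≡r+a*k+[b∸a]*k : ∀ r {a b} → a ≤ b → r + b * k ≡ r + a * k + (b ∸ a) * k
  r+b*k≡r+a*k+[b∸a]*k r {a} {b} a≤b = begin
    r + b * k                  ≡⟨ cong (λ z → r + z * k) (m+[n∸m]≡n a≤b) ⟨
    r + (a + (b ∸ a)) * k      ≡⟨ distrib r a (b ∸ a) k ⟩
    r + a * k + (b ∸ a) * k    ∎
    where
    open ≡-Reasoning
    distrib : ∀ r a e k → r + (a + e) * k ≡ r + a * k + e * k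
    distrib = solve-∀

  congruent-+* : ∀ r x y → Congruent k (r + x * k) (r + y * k)
  congruent-+* r x y with ≤-total x y
  ... | inj₁ x≤y = y ∸ x , inj₂ (r+b*k≡r+a*k+[b∸a]*k r x≤y)
  ... | inj₂ y≤x = x ∸ y , inj₁ (r+b*k≡r+a*k+[b∸a]*k r y≤x)

  %≡⇒Congruent : ∀ a b → a % k ≡ b % k → Congruent k a b
  %≡⇒Congruent a b a%≡b% = subst₂ (Congruent k) (sym (m≡m%n+[m/n]*n a k))
    (sym (trans (m≡m%n+[m/n]*n b k) (cong (_+ (b / k) * k) (sym a%≡b%))))
    (congruent-+* (a % k) (a / k) (b / k))

  -- Picking (t w) % k copies of v gives t modulo k, since w is an inverse of v modulo k.
  invertible-multiples-reach-residues : ∀ {n} (d : Fin n → ℕ) v w q → w * v ≡ 1 + q * k →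
    k ≤ count v d → ∀ t → ∃[ c ] subsetSum c d % k ≡ t % k
  invertible-multiples-reach-residues d v w q wv≡ k≤count t =
    let c , Σ≡ = subsetSum-copies v d ((t * w) % k) (≤-trans (<⇒≤ (m%n<n (t * w) k)) k≤count) in
    c , (begin
      subsetSum c d % k            ≡⟨ cong (_% k) Σ≡ ⟩
      ((t * w) % k * v) % k        ≡⟨ [m%k*n]%k≡[m*n]%k (t * w) v ⟩
      (t * w * v) % k              ≡⟨ cong (_% k) (trans (*-assoc t w v) (cong (t *_) wv≡)) ⟩
      (t * (1 + q * k)) % k        ≡⟨ cong (_% k) (expand t q k) ⟩
      (t + t * q * k) % k          ≡⟨ [m+kn]%n≡m%n t (t * q) k ⟩
      t % k                        ∎)
    where
    open ≡-Reasoning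
    expand : ∀ t q k → t * (1 + q * k) ≡ t + t * q * k
    expand = solve-∀

2*k≤m+n⇒k≤m⊎k≤n : ∀ k a b → 2 * k ≤ a + b → k ≤ a ⊎ k ≤ b
2*k≤m+n⇒k≤m⊎k≤n k a b 2k≤a+b with k ≤? a
... | yes k≤a = inj₁ k≤a
... | no  k≰a = inj₂ (+-cancelˡ-≤ k k b (begin
  k + k        ≡⟨ cong (k +_) (+-identityʳ k) ⟨
  2 * k        ≤⟨ 2k≤a+b ⟩
  a + b        ≤⟨ +-monoˡ-≤ b (<⇒≤ (≰⇒> k≰a)) ⟩
  k + b        ∎))
  where open ≤-Reasoning

-- 2 (j + 1) = k + 1, so j + 1 inverts 2 modulo k = 2 j + 1.
odd-subsetSum-hits-residue : ∀ {n} j (d : Fin n → ℕ) →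
  2 * suc (2 * j) ≤ count 1 d + count 2 d →
  ∀ base m → ∃[ c ] Congruent (suc (2 * j)) (base + subsetSum c d) m
odd-subsetSum-hits-residue j d 2k≤count base m =
  let c , Σ≡t = residue (m + 2 * j * base) in
  c , %≡⇒Congruent k _ m (begin
    (base + subsetSum c d) % k        ≡⟨ [m+n%k]%k≡[m+n]%k k base (subsetSum c d) ⟨
    (base + subsetSum c d % k) % k    ≡⟨ cong (λ x → (base + x) % k) Σ≡t ⟩
    (base + t % k) % k                ≡⟨ [m+n%k]%k≡[m+n]%k k base t ⟩
    (base + t) % k                    ≡⟨ cong (_% k) (wrap base m j) ⟩
    (m + base * k) % k                ≡⟨ [m+kn]%n≡m%n m base k ⟩
    m % k                             ∎)
  where
  open ≡-Reasoning
  k : ℕ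
  k = suc (2 * j)
  t : ℕ
  t = m + 2 * j * base
  wrap : ∀ base m j → base + (m + 2 * j * base) ≡ m + base * suc (2 * j)
  wrap = solve-∀
  two-inverse : ∀ j → suc j * 2 ≡ 1 + 1 * suc (2 * j)
  two-inverse = solve-∀
  residue : ∀ t → ∃[ c ] subsetSum c d % k ≡ t % k
  residue with 2*k≤m+n⇒k≤m⊎k≤n k (count 1 d) (count 2 d) 2k≤count
  ... | inj₁ k≤ones = invertible-multiples-reach-residues k d 1 1 0 refl k≤ones
  ... | inj₂ k≤twos = invertible-multiples-reach-residues k d 2 (suc j) 1 (two-inverse j) k≤twos

data LastOrInject₁ : ∀ {ℓ} → Fin (suc ℓ) → Set where
  is-last     : ∀ {ℓ} → LastOrInject₁ (fromℕ ℓ)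
  is-inject₁  : ∀ {ℓ} (j : Fin ℓ) → LastOrInject₁ (inject₁ j)

lastOrInject₁ : ∀ {ℓ} (i : Fin (suc ℓ)) → LastOrInject₁ i
lastOrInject₁ {zero}  zero    = is-last
lastOrInject₁ {suc ℓ} zero    = is-inject₁ zero
lastOrInject₁ {suc ℓ} (suc i) with lastOrInject₁ i
... | is-last      = is-last
... | is-inject₁ j = is-inject₁ (suc j)

module _ {ℓ : ℕ} where

  toℕ-next : (i : Fin (suc ℓ)) → toℕ (next i) ≡ suc (toℕ i) % suc ℓ
  toℕ-next i = toℕ-fromℕ< (m%n<n (suc (toℕ i)) (suc ℓ))

  toℕ-prev : (i : Fin (suc ℓ)) → toℕ (prev i) ≡ (toℕ i + ℓ) % suc ℓ
  toℕ-prev i = toℕ-fromℕ< (m%n<n (toℕ i + ℓ) (suc ℓ))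

  next-inject₁ : (j : Fin ℓ) → next (inject₁ j) ≡ suc j
  next-inject₁ j = toℕ-injective (begin
    toℕ (next (inject₁ j))     ≡⟨ toℕ-next (inject₁ j) ⟩
    suc (toℕ (inject₁ j)) % suc ℓ ≡⟨ cong (λ x → suc x % suc ℓ) (toℕ-inject₁ j) ⟩
    suc (toℕ j) % suc ℓ        ≡⟨ m<n⇒m%n≡m (s≤s (toℕ<n j)) ⟩
    suc (toℕ j)                ∎)
    where open ≡-Reasoning

  next-fromℕ : next (fromℕ ℓ) ≡ zero
  next-fromℕ = toℕ-injective (begin
    toℕ (next (fromℕ ℓ))       ≡⟨ toℕ-next (fromℕ ℓ) ⟩
    suc (toℕ (fromℕ ℓ)) % suc ℓ ≡⟨ cong (λ x → suc x % suc ℓ) (toℕ-fromℕ ℓ) ⟩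
    suc ℓ % suc ℓ              ≡⟨ n%n≡0 (suc ℓ) ⟩
    0                          ∎)
    where open ≡-Reasoning

  prev-suc : (j : Fin ℓ) → prev (suc j) ≡ inject₁ j
  prev-suc j = toℕ-injective (begin
    toℕ (prev (suc j))         ≡⟨ toℕ-prev (suc j) ⟩
    (suc (toℕ j) + ℓ) % suc ℓ  ≡⟨ cong (_% suc ℓ) (+-suc (toℕ j) ℓ) ⟨
    (toℕ j + suc ℓ) % suc ℓ    ≡⟨ [m+n]%n≡m%n (toℕ j) (suc ℓ) ⟩
    toℕ j % suc ℓ              ≡⟨ m<n⇒m%n≡m (m<n⇒m<1+n (toℕ<n j)) ⟩
    toℕ j                      ≡⟨ toℕ-inject₁ j ⟨
    toℕ (inject₁ j)            ∎)
    where open ≡-Reasoning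

  prev-zero : prev zero ≡ fromℕ ℓ
  prev-zero = toℕ-injective (trans (toℕ-prev zero) (trans (m<n⇒m%n≡m ≤-refl) (sym (toℕ-fromℕ ℓ))))

prev-next : ∀ {ℓ} (i : Fin ℓ) → prev (next i) ≡ i
prev-next {suc ℓ} i with lastOrInject₁ i
... | is-last      = trans (cong prev next-fromℕ) prev-zero
... | is-inject₁ j = trans (cong prev (next-inject₁ j)) (prev-suc j)

next-prev : ∀ {ℓ} (i : Fin ℓ) → next (prev i) ≡ i
next-prev {suc ℓ} zero    = trans (cong next prev-zero) next-fromℕ
next-prev {suc ℓ} (suc j) = trans (cong next (prev-suc j)) (next-inject₁ j)

next≢ : ∀ {ℓ} → 2 ≤ ℓ → (i : Fin ℓ) → next i ≢ i
next≢ {suc zero}    (s≤s ()) _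
next≢ {suc (suc ℓ)} _ i with lastOrInject₁ i
... | is-last      = λ next≡ → 0≢1+n (trans (cong toℕ (trans (sym next-fromℕ) next≡)) (toℕ-fromℕ (suc ℓ)))
... | is-inject₁ j = λ next≡ → 1+n≢n (trans (cong toℕ (trans (sym (next-inject₁ j)) next≡)) (toℕ-inject₁ j))

prev≢ : ∀ {ℓ} → 2 ≤ ℓ → (i : Fin ℓ) → prev i ≢ i
prev≢ 2≤ℓ i prev≡ = next≢ 2≤ℓ i (trans (cong next (sym prev≡)) (next-prev i))

module _ {A : Set} where

  unique-++⁻ˡ : ∀ (xs : List A) {ys} → Unique (xs ++ ys) → Unique xs
  unique-++⁻ˡ []       _         = []
  unique-++⁻ˡ (x ∷ xs) (x∉ ∷ u) = All.++⁻ˡ xs x∉ ∷ unique-++⁻ˡ xs u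

  unique-++⇒disjoint : ∀ (xs : List A) {ys v} → Unique (xs ++ ys) → v ∈ xs → v ∈ ys → ⊥
  unique-++⇒disjoint (x ∷ xs) (x∉ ∷ u) (here refl) v∈ys = All.lookup x∉ (∈-++⁺ʳ xs v∈ys) refl
  unique-++⇒disjoint (x ∷ xs) (x∉ ∷ u) (there v∈xs) v∈ys = unique-++⇒disjoint xs u v∈xs v∈ys

  length-concat-tabulate : ∀ {k} (f : Fin k → List A) →
                           length (concat (tabulate f)) ≡ ∑[ i < k ] length (f i)
  length-concat-tabulate {zero}  f = refl
  length-concat-tabulate {suc k} f =
    trans (length-++ (f zero)) (cong (length (f zero) +_) (length-concat-tabulate (f ∘ suc)))

module _ {n : ℕ} {R : Fin n → Fin n → Set} where

  linked-++⁻ˡ : ∀ xs {ys} → Linked R (xs ++ ys) → Linked R xs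
  linked-++⁻ˡ []           _        = []
  linked-++⁻ˡ (x ∷ [])     _        = [-]
  linked-++⁻ˡ (x ∷ y ∷ xs) (r ∷ rs) = r ∷ linked-++⁻ˡ (y ∷ xs) rs

  linked-∷ʳ⇒lastOf : ∀ h ts {z} → Linked R ((h ∷ ts) ++ [ z ]) → R (lastOf h ts) z
  linked-∷ʳ⇒lastOf h []       (r ∷ _)  = r
  linked-∷ʳ⇒lastOf h (t ∷ ts) (_ ∷ rs) = linked-∷ʳ⇒lastOf t ts rs

  linked-++-∷ : ∀ xs {y ys} → Linked R (xs ++ [ y ]) → Linked R (y ∷ ys) → Linked R (xs ++ y ∷ ys)
  linked-++-∷ []           _        l = l
  linked-++-∷ (x ∷ [])     (r ∷ _)  l = r ∷ l
  linked-++-∷ (x ∷ y ∷ xs) (r ∷ rs) l = r ∷ linked-++-∷ (y ∷ xs) rs l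

  linked-join : ∀ h ts {us} → Linked R (h ∷ ts) → Linked R (lastOf h ts ∷ us) → Linked R ((h ∷ ts) ++ us)
  linked-join h []       _        l = l
  linked-join h (t ∷ ts) (r ∷ rs) l = r ∷ linked-join t ts rs l

  linked-concat-tabulate : ∀ {k} (S : Fin (suc k) → VSeq n) {z} →
    (∀ i → Linked R (verts (S (inject₁ i)) ++ [ first (S (suc i)) ])) →
    Linked R (verts (S (fromℕ k)) ++ [ z ]) →
    Linked R (concat (tabulate (verts ∘ S)) ++ [ z ])
  linked-concat-tabulate {zero} S {z} _ closing =
    subst (λ xs → Linked R (xs ++ [ z ])) (sym (++-identityʳ (verts (S zero)))) closing
  linked-concat-tabulate {suc k} S {z} steps closing =
    subst (Linked R) (sym (++-assoc (verts (S zero)) _ [ z ]))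
      (linked-++-∷ (verts (S zero)) (steps zero) (linked-concat-tabulate (S ∘ suc) (steps ∘ suc) closing))

  cyclic-concat : ∀ {ℓ} → 1 ≤ ℓ → (S : Fin ℓ → VSeq n) →
    (∀ i → Linked R (verts (S i) ++ [ first (S (next i)) ])) →
    ∃[ c ] verts c ≡ concat (tabulate (verts ∘ S)) × Linked R (verts c ++ [ first c ])
  cyclic-concat {suc ℓ} _ S step =
    first (S zero) ∷ₚ (rest (S zero) ++ concat (tabulate (verts ∘ S ∘ suc))) , refl ,
    linked-concat-tabulate S
      (λ i → subst (λ j → Linked R (verts (S (inject₁ i)) ++ [ first (S j) ])) (next-inject₁ i) (step (inject₁ i)))
      (subst (λ j → Linked R (verts (S (fromℕ ℓ)) ++ [ first (S j) ])) next-fromℕ (step (fromℕ ℓ)))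

module _ {n : ℕ} where

  closed-walk⇒cycle : ∀ {V : Fin n → Set} {E} (c : VSeq n) → 2 ≤ len c → Unique (verts c) →
    All V (verts c) → Linked E (verts c ++ [ first c ]) → IsCycleIn V E c
  closed-walk⇒cycle c@(h ∷ₚ ts) 2≤len unique inV walk =
    2≤len , (unique , linked-++⁻ˡ (verts c) walk , inV) , linked-∷ʳ⇒lastOf h ts walk

  consec-linked : ∀ (xs : List (Fin n)) → Linked (Consec xs) xs
  consec-linked []           = []
  consec-linked (x ∷ [])     = [-]
  consec-linked (x ∷ y ∷ xs) = here ∷ Linked.map there (consec-linked (y ∷ xs))

  dropLast : List (Fin n) → List (Fin n)
  dropLast []           = []
  dropLast (_ ∷ [])     = []
  dropLast (x ∷ y ∷ ys) = x ∷ dropLast (y ∷ ys)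

  ∷≡dropLast∷ʳlastOf : ∀ t ts → t ∷ ts ≡ dropLast (t ∷ ts) ++ [ lastOf t ts ]
  ∷≡dropLast∷ʳlastOf t []       = refl
  ∷≡dropLast∷ʳlastOf t (u ∷ us) = cong (t ∷_) (∷≡dropLast∷ʳlastOf u us)

  length-dropLast : ∀ t ts → suc (length (dropLast (t ∷ ts))) ≡ length (t ∷ ts)
  length-dropLast t []       = refl
  length-dropLast t (u ∷ us) = cong suc (length-dropLast u us)

  interior : VSeq n → List (Fin n)
  interior p = dropLast (rest p)

  rest≡interior∷ʳlastV : (p : VSeq n) → 1 ≤ len p → rest p ≡ interior p ++ [ lastV p ]
  rest≡interior∷ʳlastV (h ∷ₚ (t ∷ ts)) _ = ∷≡dropLast∷ʳlastOf t ts

  suc-length-interior : (p : VSeq n) → 1 ≤ len p → suc (length (interior p)) ≡ len p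
  suc-length-interior (h ∷ₚ (t ∷ ts)) _ = length-dropLast t ts

  module _ (p : VSeq n) (1≤len : 1 ≤ len p) (unique : Unique (verts p)) where

    private
      unique-rest : Unique (interior p ++ [ lastV p ])
      unique-rest = subst Unique (rest≡interior∷ʳlastV p 1≤len) (AllPairs.tail unique)

    interior-unique : Unique (interior p)
    interior-unique = unique-++⁻ˡ (interior p) unique-rest

    ∈-interior⇒Interior : ∀ {v} → v ∈ interior p → Interior p v
    ∈-interior⇒Interior {v} v∈ =
      there v∈rest ,
      (λ v≡first → All.lookup (AllPairs.head unique) v∈rest (sym v≡first)) ,
      (λ v≡last → unique-++⇒disjoint (interior p) unique-rest v∈ (here v≡last))
      where
      v∈rest : v ∈ rest p
      v∈rest = subst (v ∈_) (sym (rest≡interior∷ʳlastV p 1≤len)) (∈-++⁺ˡ v∈)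

  first≢lastV⇒1≤len : (p : VSeq n) → first p ≢ lastV p → 1 ≤ len p
  first≢lastV⇒1≤len (h ∷ₚ [])      h≢h = contradiction refl h≢h
  first≢lastV⇒1≤len (h ∷ₚ (_ ∷ _)) _   = s≤s z≤n

  lastOf∈ : ∀ h (ts : List (Fin n)) → lastOf h ts ∈ h ∷ ts
  lastOf∈ h []       = here refl
  lastOf∈ h (t ∷ ts) = there (lastOf∈ t ts)

k*a≤∑ : ∀ {k} (f : Fin k → ℕ) a → (∀ i → a ≤ f i) → k * a ≤ ∑[ i < k ] f i
k*a≤∑ {zero}  f a a≤f = z≤n
k*a≤∑ {suc k} f a a≤f = +-mono-≤ (a≤f zero) (k*a≤∑ (f ∘ suc) a (a≤f ∘ suc))

module _ (G : Graph) (N : Necklace G) where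

  open Graph G
  open Necklace N

  BeadPath : Fin ℓ → VSeq n → Set
  BeadPath i p = IsPathIn (V (B i)) (E (B i)) p × first p ≡ xv i × lastV p ≡ yv i

  xv∈B : ∀ i → V (B i) (xv i)
  xv∈B i = subst (λ j → V (B j) (xv i)) (next-prev i) (P-last (prev i))

  xv-next≡lastV : ∀ i → xv (next i) ≡ lastV (P i)
  xv-next≡lastV i = cong (λ j → lastV (P j)) (prev-next i)

  record PathPair (i : Fin ℓ) : Set where
    field
      short long : VSeq n
      short-bead : BeadPath i short
      long-bead  : BeadPath i long
      gap        : ℕ
      len-long   : len long ≡ len short + gap

    choose : Bool → VSeq n
    choose b = if b then long else short

    choose-bead : ∀ b → BeadPath i (choose b)
    choose-bead true  = long-bead
    choose-bead false = short-bead

    len-choose : ∀ b → len (choose b) ≡ len short + select b gap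
    len-choose true  = len-long
    len-choose false = sym (+-identityʳ _)

  open PathPair

  bead-pair : ∀ {i p q} g → BeadPath i p → BeadPath i q → len q ≡ len p + g → PathPair i
  bead-pair g p-bead q-bead len≡ =
    record { short-bead = p-bead ; long-bead = q-bead ; gap = g ; len-long = len≡ }

  connected-pair : ∀ i → PathPair i
  connected-pair i with p , p-bead ← proj₁ (proj₂ (B-2conn i)) (xv i) (yv i) (xv∈B i) (P-first i) =
    bead-pair 0 p-bead p-bead (sym (+-identityʳ (len p)))

  wiggly⇒path-pairs : ∀ {w} → Wiggly w →
    ∃[ I ] ∣ I ∣ ≡ w × ((i : Fin ℓ) → Σ (PathPair i) λ D → i ∈ₛ I → gap D ≡ 1 ⊎ gap D ≡ 2)
  wiggly⇒path-pairs (I , ∣I∣≡w , wiggle) = I , ∣I∣≡w , pair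
    where
    pair : (i : Fin ℓ) → Σ (PathPair i) λ D → i ∈ₛ I → gap D ≡ 1 ⊎ gap D ≡ 2
    pair i with i ∈? I
    ... | no  i∉I = connected-pair i , λ i∈I → contradiction i∈I i∉I
    ... | yes i∈I with wiggle i i∈I
    ...   | _ , _ , p-path , p-first , p-last , q-path , q-first , q-last , inj₁ len≡ =
            bead-pair 1 (p-path , p-first , p-last) (q-path , q-first , q-last) len≡ , λ _ → inj₁ refl
    ...   | _ , _ , p-path , p-first , p-last , q-path , q-first , q-last , inj₂ len≡ =
            bead-pair 2 (p-path , p-first , p-last) (q-path , q-first , q-last) len≡ , λ _ → inj₂ refl

  baseLength : (∀ i → PathPair i) → ℕ
  baseLength D = ∑[ i < ℓ ] (len (short (D i)) + len (P i))

  module _ (2≤ℓ : 2 ≤ ℓ) where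

    1≤len-P : ∀ i → 1 ≤ len (P i)
    1≤len-P i = first≢lastV⇒1≤len (P i) λ first≡last →
      B-disj i (next i) (next≢ 2≤ℓ i ∘ sym) (first (P i)) (P-first i)
        (subst (V (B (next i))) (sym first≡last) (P-last i))

    xv≢yv : ∀ i → xv i ≢ yv i
    xv≢yv i x≡y = P-disj (prev i) i (prev≢ 2≤ℓ i) (xv i)
      (lastOf∈ (first (P (prev i))) (rest (P (prev i))))
      (subst (_∈ verts (P i)) (sym x≡y) (here refl))

    module Cycle (D : ∀ i → PathPair i) (c : Fin ℓ → Bool) where

      Q : Fin ℓ → VSeq n
      Q i = choose (D i) (c i)

      segment : Fin ℓ → VSeq n
      segment i = first (Q i) ∷ₚ (rest (Q i) ++ interior (P i))

      first-segment : ∀ i → first (segment i) ≡ xv i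
      first-segment i = proj₁ (proj₂ (choose-bead (D i) (c i)))

      module _ (i : Fin ℓ) where
        private
          Q-path : IsPathIn (V (B i)) (E (B i)) (Q i)
          Q-path = proj₁ (choose-bead (D i) (c i))
          Q-last : lastV (Q i) ≡ yv i
          Q-last = proj₂ (proj₂ (choose-bead (D i) (c i)))
          P-unique : Unique (verts (P i))
          P-unique = proj₁ (P-path i)

        segment-walk : Linked NE (verts (segment i) ++ [ first (segment (next i)) ])
        segment-walk = subst (Linked NE) Q++P≡ (linked-join (first (Q i)) (rest (Q i)) Q-walk P-walk)
          where
          open ≡-Reasoning
          Q-walk : Linked NE (verts (Q i))
          Q-walk = Linked.map (λ e → inj₁ (i , e)) (proj₁ (proj₂ Q-path))
          P-walk : Linked NE (lastV (Q i) ∷ rest (P i))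
          P-walk = subst (λ v → Linked NE (v ∷ rest (P i))) (sym Q-last)
                     (Linked.map (λ e → inj₂ (i , inj₁ e)) (consec-linked (verts (P i))))
          Q++P≡ : verts (Q i) ++ rest (P i) ≡ verts (segment i) ++ [ first (segment (next i)) ]
          Q++P≡ = begin
            verts (Q i) ++ rest (P i)
              ≡⟨ cong (verts (Q i) ++_) (rest≡interior∷ʳlastV (P i) (1≤len-P i)) ⟩
            verts (Q i) ++ interior (P i) ++ [ lastV (P i) ]
              ≡⟨ ++-assoc (verts (Q i)) (interior (P i)) _ ⟨
            verts (segment i) ++ [ lastV (P i) ]
              ≡⟨ cong (λ v → verts (segment i) ++ [ v ]) (trans (first-segment (next i)) (xv-next≡lastV i)) ⟨
            verts (segment i) ++ [ first (segment (next i)) ] ∎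

        ∈-segment : ∀ {v} → v ∈ verts (segment i) → V (B i) v ⊎ Interior (P i) v
        ∈-segment {v} v∈ with ∈-++⁻ (verts (Q i)) v∈
        ... | inj₁ v∈Q = inj₁ (All.lookup (proj₂ (proj₂ Q-path)) v∈Q)
        ... | inj₂ v∈P = inj₂ (∈-interior⇒Interior (P i) (1≤len-P i) P-unique v∈P)

        segment-unique : Unique (verts (segment i))
        segment-unique = Unique.++⁺ (proj₁ Q-path) (interior-unique (P i) (1≤len-P i) P-unique)
          λ (v∈Q , v∈P) → P-int i i _ (∈-interior⇒Interior (P i) (1≤len-P i) P-unique v∈P)
                                     (All.lookup (proj₂ (proj₂ Q-path)) v∈Q)

        length-segment : length (verts (segment i)) ≡ len (Q i) + len (P i)
        length-segment = begin
          length (verts (Q i) ++ interior (P i))    ≡⟨ length-++ (verts (Q i)) ⟩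
          suc (len (Q i)) + length (interior (P i)) ≡⟨ +-suc (len (Q i)) _ ⟨
          len (Q i) + suc (length (interior (P i))) ≡⟨ cong (len (Q i) +_) (suc-length-interior (P i) (1≤len-P i)) ⟩
          len (Q i) + len (P i)                     ∎
          where open ≡-Reasoning

        2≤length-segment : 2 ≤ length (verts (segment i))
        2≤length-segment = subst (2 ≤_) (sym length-segment)
          (+-mono-≤ (first≢lastV⇒1≤len (Q i) λ first≡last → xv≢yv i (trans (sym (first-segment i)) (trans first≡last Q-last)))
                    (1≤len-P i))

      segments-disjoint : ∀ {i j} → i ≢ j → Disjoint (verts (segment i)) (verts (segment j))
      segments-disjoint {i} {j} i≢j (v∈i , v∈j) with ∈-segment i v∈i | ∈-segment j v∈j
      ... | inj₁ v∈Bi  | inj₁ v∈Bj  = B-disj i j i≢j _ v∈Bi v∈Bj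
      ... | inj₁ v∈Bi  | inj₂ v∈Pj° = P-int j i _ v∈Pj° v∈Bi
      ... | inj₂ v∈Pi° | inj₁ v∈Bj  = P-int i j _ v∈Pi° v∈Bj
      ... | inj₂ v∈Pi° | inj₂ v∈Pj° = P-disj i j i≢j _ (proj₁ v∈Pi°) (proj₁ v∈Pj°)

      closed-walk : ∃[ cyc ] verts cyc ≡ concat (tabulate (verts ∘ segment))
                             × Linked NE (verts cyc ++ [ first cyc ])
      closed-walk = cyclic-concat (≤-trans (s≤s z≤n) 2≤ℓ) segment segment-walk

      cycle : VSeq n
      cycle = proj₁ closed-walk

      verts-cycle : verts cycle ≡ concat (tabulate (verts ∘ segment))
      verts-cycle = proj₁ (proj₂ closed-walk)

      cycleLength≡∑segments : cycleLength cycle ≡ ∑[ i < ℓ ] length (verts (segment i))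
      cycleLength≡∑segments =
        trans (cong length verts-cycle) (length-concat-tabulate (verts ∘ segment))

      cycle-is-cycle : IsCycleIn NV NE cycle
      cycle-is-cycle = closed-walk⇒cycle cycle 2≤len unique inNV (proj₂ (proj₂ closed-walk))
        where
        unique : Unique (verts cycle)
        unique = subst Unique (sym verts-cycle)
          (Unique.concat⁺ (All.tabulate⁺ segment-unique) (AllPairs.tabulate⁺ segments-disjoint))
        inNV : All NV (verts cycle)
        inNV = subst (All NV) (sym verts-cycle) (All.concat⁺ (All.tabulate⁺ λ i → All.tabulate λ v∈ →
          Sum.map (i ,_) (λ v∈P° → i , proj₁ v∈P°) (∈-segment i v∈)))
        4≤cycleLength : 2 * 2 ≤ cycleLength cycle
        4≤cycleLength = subst (2 * 2 ≤_) (sym cycleLength≡∑segments)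
          (≤-trans (*-monoˡ-≤ 2 2≤ℓ) (k*a≤∑ _ 2 2≤length-segment))
        2≤len : 2 ≤ len cycle
        2≤len = ≤-trans (n≤1+n 2) (s≤s⁻¹ 4≤cycleLength)

      cycleLength≡base+subsetSum : cycleLength cycle ≡ baseLength D + subsetSum c (gap ∘ D)
      cycleLength≡base+subsetSum = begin
        cycleLength cycle
          ≡⟨ cycleLength≡∑segments ⟩
        ∑[ i < ℓ ] length (verts (segment i))
          ≡⟨ sum-cong-≗ split ⟩
        ∑[ i < ℓ ] (len (short (D i)) + len (P i) + select (c i) (gap (D i)))
          ≡⟨ ∑-distrib-+ (λ i → len (short (D i)) + len (P i)) (λ i → select (c i) (gap (D i))) ⟩
        baseLength D + subsetSum c (gap ∘ D)
          ∎
        where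
        open ≡-Reasoning
        swap : ∀ a b c → a + b + c ≡ a + c + b
        swap = solve-∀
        split : ∀ i → length (verts (segment i)) ≡ len (short (D i)) + len (P i) + select (c i) (gap (D i))
        split i = trans (length-segment i) (trans (cong (_+ len (P i)) (len-choose (D i) (c i)))
          (swap (len (short (D i))) (select (c i) (gap (D i))) (len (P i))))

  path-pairs⇒cycle-mod : ∀ j m (I : Subset ℓ) → ∣ I ∣ ≡ 2 * suc (2 * j) →
    (pairs : ∀ i → Σ (PathPair i) λ D → i ∈ₛ I → gap D ≡ 1 ⊎ gap D ≡ 2) →
    HasCycleMod (suc (2 * j)) m
  path-pairs⇒cycle-mod j m I ∣I∣≡2k pairs =
    let c , ≡m = odd-subsetSum-hits-residue j (gap ∘ D) 2k≤count (baseLength D) m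
        open Cycle 2≤ℓ D c
    in cycle , cycle-is-cycle ,
       subst (λ x → Congruent (suc (2 * j)) x m) (sym cycleLength≡base+subsetSum) ≡m
    where
    D : ∀ i → PathPair i
    D i = proj₁ (pairs i)
    2k≤count : 2 * suc (2 * j) ≤ count 1 (gap ∘ D) + count 2 (gap ∘ D)
    2k≤count = subst (_≤ count 1 (gap ∘ D) + count 2 (gap ∘ D)) ∣I∣≡2k
                     (∣I∣≤count₁+count₂ I (gap ∘ D) (proj₂ ∘ pairs))
    2≤ℓ : 2 ≤ ℓ
    2≤ℓ = ≤-trans (*-monoʳ-≤ 2 (s≤s z≤n)) (subst (_≤ ℓ) ∣I∣≡2k (∣p∣≤n I))

lemma2p7 : (G : Graph) (N : Necklace G) (k m : ℕ) → Odd k →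
    Necklace.Wiggly N (2 * k) → Necklace.HasCycleMod N k m
lemma2p7 G N k m (j , refl) wiggly =
  let I , ∣I∣≡2k , pairs = wiggly⇒path-pairs G N wiggly
  in path-pairs⇒cycle-mod G N j m I ∣I∣≡2k pairs
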